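{- Let $G$ be a finite nilpotent group. Then the order supergraph $\mathcal{S}(G)$ is the line graph of some graph if and only if $G$ is a $p$-group for some prime $p$.
   Context: For a finite group $G$, the order supergraph $\mathcal{S}(G)$ is the simple undirected graph with vertex set $G$ in which distinct $x,y$ are adjacent if and only if $o(x)\mid o(y)$ or $o(y)\mid o(x)$, where $o(x)$ is the order of $x$. A graph is a line graph if it is isomorphic to the line graph $L(\Gamma)$ of some simple graph $\Gamma$ (vertices of $L(\Gamma)$ are the edges of $\Gamma$, adjacent when they share an endpoint). -}

module Defs where

open import Data.Nat using (ℕ; zero; suc; _<_; _^_)
open import Data.Nat.Divisibility using (_∣_)
open import Data.Fin using (Fin)
import Data.Fin as F
open import Data.Bool using (Bool; T)
open import Data.Product using (Σ; ∃; ∃-syntax; _×_; _,_; proj₁; proj₂)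
open import Data.Sum using (_⊎_)
open import Relation.Nullary using (¬_)
open import Relation.Binary.PropositionalEquality using (_≡_; _≢_)
open import Data.Nat.Primality using (Prime)
open import Function.Bundles using (_↔_; _⇔_; Inverse)

record FiniteGroup (n : ℕ) : Set where
  field
    _∙_   : Fin n → Fin n → Fin n
    ε     : Fin n
    _⁻¹   : Fin n → Fin n
    assoc : ∀ x y z → (x ∙ y) ∙ z ≡ x ∙ (y ∙ z)
    identityˡ : ∀ x → ε ∙ x ≡ x
    identityʳ : ∀ x → x ∙ ε ≡ x
    inverseˡ  : ∀ x → (x ⁻¹) ∙ x ≡ ε
    inverseʳ  : ∀ x → x ∙ (x ⁻¹) ≡ ε

  infixl 7 _∙_

  pow : Fin n → ℕ → Fin n
  pow x zero    = ε
  pow x (suc k) = x ∙ pow x k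

  IsOrder : Fin n → ℕ → Set
  IsOrder x k = (0 < k) × (pow x k ≡ ε) × (∀ j → 0 < j → j < k → pow x j ≢ ε)

  comm : Fin n → Fin n → Fin n
  comm x g = (x ⁻¹) ∙ (g ⁻¹) ∙ x ∙ g

  -- upper central series: Z 0 = {e}, Z (i+1) = {x | [x,g] ∈ Z i for all g}
  -- (i.e. Z (i+1)/Z i = Z(G/Z i))
  Z : ℕ → Fin n → Set
  Z zero    x = x ≡ ε
  Z (suc i) x = ∀ g → Z i (comm x g)

IsNilpotent : ∀ {n} → FiniteGroup n → Set
IsNilpotent G = ∃[ c ] (∀ x → FiniteGroup.Z G c x)

IsPGroup : ∀ {n} → FiniteGroup n → Set
IsPGroup {n} G = ∃[ p ] (Prime p × ∃[ k ] (n ≡ p ^ k))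

SAdj : ∀ {n} → FiniteGroup n → Fin n → Fin n → Set
SAdj G x y = x ≢ y × ∃[ k ] ∃[ l ] (IsOrder x k × IsOrder y l × (k ∣ l ⊎ l ∣ k))
  where open FiniteGroup G

record SimpleGraph (m : ℕ) : Set where
  field
    adj     : Fin m → Fin m → Bool
    sym     : ∀ u v → adj u v ≡ adj v u
    irrefl  : ∀ u → ¬ T (adj u u)

-- edges of Γ, each unordered edge {u,v} represented once as (u , v) with u < v
Edge : ∀ {m} → SimpleGraph m → Set
Edge {m} Γ = Σ (Fin m × Fin m) λ uv → (proj₁ uv F.< proj₂ uv) × T (SimpleGraph.adj Γ (proj₁ uv) (proj₂ uv))

LAdj : ∀ {m} (Γ : SimpleGraph m) → Edge Γ → Edge Γ → Set
LAdj Γ ((a , b) , _) ((c , d) , _) =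
  ((a , b) ≢ (c , d)) × (a ≡ c ⊎ a ≡ d ⊎ b ≡ c ⊎ b ≡ d)

IsLineGraphS : ∀ {n} → FiniteGroup n → Set
IsLineGraphS {n} G =
  ∃[ m ] Σ (SimpleGraph m) λ Γ → Σ (Fin n ↔ Edge Γ) λ f →
    ∀ x y → SAdj G x y ⇔ LAdj Γ (Inverse.to f x) (Inverse.to f y)

-- If G is a p-group, every element order divides |G| = pᵏ and so is a power of p; any two orders are
-- then comparable, S(G) is complete, and a complete graph on n vertices is the line graph of the star
-- K₁,ₙ. Conversely, a nontrivial nilpotent group has a central element z of prime order p. If |G| is
-- not a power of p, Cauchy's theorem gives y of prime order q ≠ p, and w = zy has order M divisible
-- by pq. The elements u, v of orders p, q in ⟨w⟩ are not adjacent in S(G), while ε, w, w⁻¹ are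
-- pairwise adjacent and adjacent to both: this is K₅ minus an edge, which no line graph contains,
-- because the edges meeting two disjoint edges {a, b} and {c, d} form a 4-cycle, and a 4-cycle has
-- no triangle.

module Submission where

open import Defs
open import Level using (0ℓ)
open import Function.Base using (_∘_; id; flip)
open import Function.Bundles using (_⇔_; mk⇔; Equivalence; Inverse; Injection; _↔_; mk↔ₛ′)
open import Function.Properties.Inverse using (↔⇒↣)
open import Data.Empty using (⊥)
open import Data.Product using (∃; ∃-syntax; _×_; _,_; proj₁; proj₂)
open import Data.Sum using (_⊎_; inj₁; inj₂; [_,_]′)
import Data.Sum as Sum
open import Data.Bool using (Bool; true; false; _xor_; T)
open import Data.Bool.Properties using (not-injective; xor-comm; T-irrelevant)
open import Relation.Nullary using (¬_; yes; no; contradiction; ¬?)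
open import Relation.Nullary.Decidable using (_×-dec_; decidable-stable)
open import Relation.Unary using (Decidable)
open import Relation.Binary.Definitions using (DecidableEquality; tri<; tri≈; tri>)
open import Relation.Binary.PropositionalEquality hiding ([_])

open import Data.Nat using (ℕ; zero; suc; _+_; _*_; _∸_; _^_; _≤_; _<_; _≟_; _<?_; z≤n; s≤s;
                            NonZero; ≢-nonZero; ≢-nonZero⁻¹; >-nonZero; >-nonZero⁻¹)
open import Data.Nat.Properties
open import Data.Nat.DivMod using (_/_; _%_; m≡m%n+[m/n]*n; m%n<n)
open import Data.Nat.Divisibility
open import Data.Nat.Induction using (<-rec)
open import Data.Nat.GeneralisedArithmetic using (fold; fold-+)
open import Data.Nat.Primality using (Prime; prime⇒irreducible; prime⇒nonZero; euclidsLemma; ¬prime[0]; ¬prime[1]; prime[2])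
open import Data.Nat.Primality.Factorisation using (factorise)
open import Data.Nat.ListAction using (product)
open import Data.Nat.ListAction.Properties using (∈⇒∣product)

open import Data.Fin using (Fin; zero; suc; toℕ)
import Data.Fin.Base as Fin
import Data.Fin.Properties as Finₚ
open import Data.Fin.Properties using (pigeonhole)

open import Data.List using (List; []; _∷_; [_]; _++_; _∷ʳ_; length; filter; map; foldr; applyUpTo; replicate; allFin;
                             cartesianProductWith)
open import Data.List.Properties using (length-applyUpTo; length-tabulate; length-map; length-++; length-replicate;
                                        ∷-injective; ∷ʳ-injective; ≡-dec; ++-assoc; ++-identityʳ)
open import Data.List.Relation.Unary.Any using (here; there)
open import Data.List.Relation.Unary.All using (All; []; _∷_; all?)
import Data.List.Relation.Unary.All as All
open import Data.List.Relation.Unary.All.Properties using (¬All⇒Any¬)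
open import Data.List.Relation.Unary.AllPairs using ([]; _∷_)
open import Data.List.Relation.Unary.Unique.Propositional using (Unique)
open import Data.List.Relation.Unary.Unique.Propositional.Properties using (applyUpTo⁺₁; filter⁺; allFin⁺; map⁺; cartesianProductWith⁺)
open import Data.List.Membership.Propositional using (_∈_; find)
open import Data.List.Membership.Propositional.Properties using (∈-length; ∈-allFin; ∈-cartesianProductWith⁺;
  ∈-cartesianProductWith⁻; ∈-map⁺; ∈-map⁻; ∈-applyUpTo⁺; ∈-applyUpTo⁻; ∈-filter⁺; ∈-filter⁻)
open import Data.List.Membership.Propositional.Properties.WithK using (unique∧set⇒bag)
open import Data.List.Relation.Binary.BagAndSetEquality using (∼bag⇒↭)
open import Data.List.Relation.Binary.Permutation.Propositional.Properties using (↭-length)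

open import Algebra.Bundles using (Group)
import Algebra.Properties.Group

open Equivalence using (to; from)

IsLeastPositive : (ℕ → Set) → ℕ → Set
IsLeastPositive P k = 0 < k × P k × (∀ j → 0 < j → j < k → ¬ P j)

module _ {P : ℕ → Set} where

  leastPositive-unique : ∀ {k l} → IsLeastPositive P k → IsLeastPositive P l → k ≡ l
  leastPositive-unique {k} {l} (0<k , pk , mink) (0<l , pl , minl) with <-cmp k l
  ... | tri< k<l _ _ = contradiction pk (minl k 0<k k<l)
  ... | tri≈ _ k≡l _ = k≡l
  ... | tri> _ _ l<k = contradiction pl (mink l 0<l l<k)

  leastPositive-resp-⇔ : ∀ {Q : ℕ → Set} → (∀ j → P j ⇔ Q j) → ∀ {k} → IsLeastPositive P k → IsLeastPositive Q k
  leastPositive-resp-⇔ P⇔Q (0<k , pk , min) = 0<k , to (P⇔Q _) pk , λ j 0<j j<k → min j 0<j j<k ∘ from (P⇔Q j)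

  leastPositive : Decidable P → ∀ k → 0 < k → P k → ∃ (IsLeastPositive P)
  leastPositive P? = <-rec _ search
    where
    search : ∀ k → (∀ {j} → j < k → 0 < j → P j → ∃ (IsLeastPositive P)) → 0 < k → P k → ∃ (IsLeastPositive P)
    search k smaller 0<k pk with anyUpTo? (λ j → (0 <? j) ×-dec P? j) k
    ... | yes (j , j<k , 0<j , pj) = smaller j<k 0<j pj
    ... | no none = k , 0<k , pk , λ j 0<j j<k pj → none (j , j<k , 0<j , pj)

record IsSubtractiveSubmonoid (P : ℕ → Set) : Set where
  field
    0∈ : P 0
    +-closed : ∀ {a b} → P a → P b → P (a + b)
    ∸-closed : ∀ {a b} → P (a + b) → P a → P b

  *-closed : ∀ c {k} → P k → P (c * k)
  *-closed zero    pk = 0∈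
  *-closed (suc c) pk = +-closed pk (*-closed c pk)

  leastPositive∣ : ∀ {k} → IsLeastPositive P k → ∀ {a} → P a → k ∣ a
  leastPositive∣ {k@(suc _)} (_ , pk , min) {a} pa = m%n≡0⇒n∣m a k (positive∉ (m%n<n a k) remainder)
    where
    remainder : P (a % k)
    remainder = ∸-closed (subst P (trans (m≡m%n+[m/n]*n a k) (+-comm (a % k) (a / k * k))) pa) (*-closed (a / k) pk)
    positive∉ : ∀ {r} → r < k → P r → r ≡ 0
    positive∉ {zero}  _   _  = refl
    positive∉ {suc r} r<k pr = contradiction pr (min (suc r) (s≤s z≤n) r<k)

  prime⇒leastPositive : Decidable P → ∀ {q} → Prime q → P q → ¬ P 1 → IsLeastPositive P q
  prime⇒leastPositive P? {q} q-prime pq ¬p1 with leastPositive P? q (>-nonZero⁻¹ q {{prime⇒nonZero q-prime}}) pq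
  ... | d , least with prime⇒irreducible q-prime (leastPositive∣ least pq)
  ...   | inj₁ refl = contradiction (proj₁ (proj₂ least)) ¬p1
  ...   | inj₂ refl = least

-- Prime powers

∃primeDivisor : ∀ m → 1 < m → ∃[ p ] Prime p × p ∣ m
∃primeDivisor m@(suc _) 1<m with factorise m
... | record { factors = [] ; isFactorisation = m≡1 } = contradiction m≡1 (>⇒≢ 1<m)
... | record { factors = p ∷ ps ; isFactorisation = m≡∏ ; factorsPrime = p-prime ∷ _ } =
  p , p-prime , subst (p ∣_) (sym m≡∏) (m∣m*n (product ps))

power∣power : ∀ p {i j} → i ≤ j → p ^ i ∣ p ^ j
power∣power p {j = j} z≤n      = 1∣ (p ^ j)
power∣power p         (s≤s i≤j) = *-monoʳ-∣ p (power∣power p i≤j)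

prime∤prime : ∀ {p q} → Prime p → Prime q → p ≢ q → ¬ p ∣ q
prime∤prime p-prime q-prime p≢q p∣q with prime⇒irreducible q-prime p∣q
... | inj₁ refl = ¬prime[1] p-prime
... | inj₂ p≡q  = p≢q p≡q

module _ {p : ℕ} (prime : Prime p) where

  prime∣power⇒≡ : ∀ {r} k → Prime r → r ∣ p ^ k → r ≡ p
  prime∣power⇒≡ zero    r-prime r∣1 with refl ← ∣1⇒≡1 r∣1 = contradiction r-prime ¬prime[1]
  prime∣power⇒≡ (suc k) r-prime r∣pᵏ⁺¹ with euclidsLemma p (p ^ k) r-prime r∣pᵏ⁺¹
  ... | inj₂ r∣pᵏ = prime∣power⇒≡ k r-prime r∣pᵏ
  ... | inj₁ r∣p with prime⇒irreducible prime r∣p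
  ...   | inj₁ refl = contradiction r-prime ¬prime[1]
  ...   | inj₂ r≡p  = r≡p

  product≡power : ∀ {xs} → All (_≡ p) xs → product xs ≡ p ^ length xs
  product≡power []           = refl
  product≡power (refl ∷ all) = cong (p *_) (product≡power all)

  power⊎otherPrimeDivisor : ∀ N → .{{NonZero N}} → (∃[ k ] N ≡ p ^ k) ⊎ (∃[ q ] Prime q × q ≢ p × q ∣ N)
  power⊎otherPrimeDivisor N with factorise N
  ... | record { factors = qs ; isFactorisation = N≡∏qs ; factorsPrime = qs-prime } with all? (_≟ p) qs
  ...   | yes all≡p = inj₁ (length qs , trans N≡∏qs (product≡power all≡p))
  ...   | no ¬all≡p with find (¬All⇒Any¬ (_≟ p) qs ¬all≡p)
  ...     | q , q∈qs , q≢p = inj₂ (q , All.lookup qs-prime q∈qs , q≢p , subst (q ∣_) (sym N≡∏qs) (∈⇒∣product q∈qs))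

  ∣power⇒power : ∀ k {d} → d ∣ p ^ k → ∃[ i ] d ≡ p ^ i
  ∣power⇒power k {zero}    0∣pᵏ = contradiction (0∣⇒≡0 0∣pᵏ) (≢-nonZero⁻¹ (p ^ k) {{m^n≢0 p k {{prime⇒nonZero prime}}}})
  ∣power⇒power k {d@(suc _)} d∣pᵏ with power⊎otherPrimeDivisor d
  ... | inj₁ d≡pⁱ = d≡pⁱ
  ... | inj₂ (q , q-prime , q≢p , q∣d) = contradiction (prime∣power⇒≡ k q-prime (∣-trans q∣d d∣pᵏ)) q≢p

module _ {A : Set} where

  length-filter-split : ∀ {P : A → Set} (P? : Decidable P) xs →
                        length (filter P? xs) + length (filter (¬? ∘ P?) xs) ≡ length xs
  length-filter-split P? [] = refl
  length-filter-split P? (x ∷ xs) with P? x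
  ... | yes _ = cong suc (length-filter-split P? xs)
  ... | no  _ = trans (+-suc _ _) (cong suc (length-filter-split P? xs))

  unique-sameElements⇒length≡ : ∀ {xs ys : List A} → Unique xs → Unique ys →
                                (∀ {z} → z ∈ xs → z ∈ ys) → (∀ {z} → z ∈ ys → z ∈ xs) → length xs ≡ length ys
  unique-sameElements⇒length≡ uxs uys xs⊆ys ys⊆xs = ↭-length (∼bag⇒↭ (unique∧set⇒bag uxs uys (mk⇔ xs⊆ys ys⊆xs)))

  rotate : List A → List A
  rotate []       = []
  rotate (x ∷ xs) = xs ∷ʳ x

  length-rotate : ∀ xs → length (rotate xs) ≡ length xs
  length-rotate []       = refl
  length-rotate (x ∷ xs) = trans (length-++ xs) (+-comm (length xs) 1)

  rotate-injective : ∀ {xs ys} → rotate xs ≡ rotate ys → xs ≡ ys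
  rotate-injective {[]}     {[]}     _  = refl
  rotate-injective {[]}     {y ∷ ys} eq = contradiction (trans (cong length eq) (length-rotate (y ∷ ys))) λ ()
  rotate-injective {x ∷ xs} {[]}     eq = contradiction (trans (sym (cong length eq)) (length-rotate (x ∷ xs))) λ ()
  rotate-injective {x ∷ xs} {y ∷ ys} eq with ∷ʳ-injective xs ys eq
  ... | refl , refl = refl

  rotate-replicate : ∀ k x → rotate (replicate k x) ≡ replicate k x
  rotate-replicate zero    x = refl
  rotate-replicate (suc k) x = replicate-∷ʳ k
    where
    replicate-∷ʳ : ∀ j → replicate j x ∷ʳ x ≡ x ∷ replicate j x
    replicate-∷ʳ zero    = refl
    replicate-∷ʳ (suc j) = cong (x ∷_) (replicate-∷ʳ j)

  rotate-fixed⇒replicate : ∀ x xs → rotate (x ∷ xs) ≡ x ∷ xs → x ∷ xs ≡ replicate (suc (length xs)) x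
  rotate-fixed⇒replicate x []       _     = refl
  rotate-fixed⇒replicate x (y ∷ ys) fixed with ∷-injective fixed
  ... | refl , ys∷x≡ys = cong (x ∷_) (rotate-fixed⇒replicate y ys ys∷x≡ys)

  words : List A → ℕ → List (List A)
  words as zero    = [ [] ]
  words as (suc k) = cartesianProductWith _∷_ as (words as k)

  length-cartesianProductWith : ∀ {B C : Set} (f : A → B → C) xs ys →
                                length (cartesianProductWith f xs ys) ≡ length xs * length ys
  length-cartesianProductWith f []       ys = refl
  length-cartesianProductWith f (x ∷ xs) ys = begin
    length (map (f x) ys ++ cartesianProductWith f xs ys)   ≡⟨ length-++ (map (f x) ys) ⟩
    length (map (f x) ys) + length (cartesianProductWith f xs ys)
      ≡⟨ cong₂ _+_ (length-map (f x) ys) (length-cartesianProductWith f xs ys) ⟩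
    length ys + length xs * length ys   ∎
    where open ≡-Reasoning

  length-words : ∀ as k → length (words as k) ≡ length as ^ k
  length-words as zero    = refl
  length-words as (suc k) = trans (length-cartesianProductWith _∷_ as (words as k)) (cong (length as *_) (length-words as k))

  words-unique : ∀ {as} → Unique as → ∀ k → Unique (words as k)
  words-unique as-unique zero    = [] ∷ []
  words-unique as-unique (suc k) = cartesianProductWith⁺ _∷_ ∷-injective as-unique (words-unique as-unique k)

  ∈-words⁺ : ∀ {as xs} → All (_∈ as) xs → xs ∈ words as (length xs)
  ∈-words⁺ []         = here refl
  ∈-words⁺ (x∈ ∷ xs∈) = ∈-cartesianProductWith⁺ _∷_ x∈ (∈-words⁺ xs∈)

  ∈-words⁻ : ∀ {as} k {xs} → xs ∈ words as k → length xs ≡ k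
  ∈-words⁻ zero    (here refl) = refl
  ∈-words⁻ {as} (suc k) xs∈ with ∈-cartesianProductWith⁻ _∷_ as (words as k) xs∈
  ... | _ , ys , _ , ys∈ , refl = cong suc (∈-words⁻ k ys∈)

  unique⇒∃≢ : DecidableEquality A → ∀ {xs} → Unique xs → 2 ≤ length xs → ∀ r → ∃[ v ] v ∈ xs × v ≢ r
  unique⇒∃≢ _≟_ {_ ∷ []}    _                 (s≤s ()) _
  unique⇒∃≢ _≟_ {a ∷ b ∷ _} ((a≢b ∷ _) ∷ _) _ r with a ≟ r
  ... | yes refl = b , there (here refl) , a≢b ∘ sym
  ... | no  a≢r  = a , here refl , a≢r

-- Periods of iteration

module Iteration {A : Set} (σ : A → A) where

  IsPeriodOf : A → ℕ → Set
  IsPeriodOf x j = fold x σ j ≡ x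

  periods-subtractive : ∀ x → IsSubtractiveSubmonoid (IsPeriodOf x)
  periods-subtractive x = record
    { 0∈       = refl
    ; +-closed = λ {a} {b} pa pb → trans (fold-+ x σ a) (trans (cong (λ y → fold y σ a) pb) pa)
    ; ∸-closed = λ {a} {b} pab pa → begin
        fold x σ b              ≡⟨ cong (λ y → fold y σ b) pa ⟨
        fold (fold x σ a) σ b   ≡⟨ fold-+ x σ b ⟨
        fold x σ (b + a)        ≡⟨ cong (fold x σ) (+-comm b a) ⟩
        fold x σ (a + b)        ≡⟨ pab ⟩
        x                       ∎
    }
    where open ≡-Reasoning

  fold-suc-inner : ∀ x j → fold x σ (suc j) ≡ fold (σ x) σ j
  fold-suc-inner x j = trans (cong (fold x σ) (+-comm 1 j)) (fold-+ x σ j)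

  orbit : ℕ → A → List A
  orbit m x = applyUpTo (fold x σ) m

  module _ {m x} (period : IsLeastPositive (IsPeriodOf x) m) where
    open IsSubtractiveSubmonoid (periods-subtractive x)

    private instance
      m≢0 : NonZero m
      m≢0 = >-nonZero (proj₁ period)

    fold-mod : ∀ j → fold x σ j ≡ fold x σ (j % m)
    fold-mod j = begin
      fold x σ j                              ≡⟨ cong (fold x σ) (m≡m%n+[m/n]*n j m) ⟩
      fold x σ (j % m + j / m * m)            ≡⟨ fold-+ x σ (j % m) ⟩
      fold (fold x σ (j / m * m)) σ (j % m)   ≡⟨ cong (λ y → fold y σ (j % m)) (*-closed (j / m) (proj₁ (proj₂ period))) ⟩
      fold x σ (j % m)                        ∎
      where open ≡-Reasoning

    fold∈orbit : ∀ j → fold x σ j ∈ orbit m x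
    fold∈orbit j = subst (_∈ orbit m x) (sym (fold-mod j)) (∈-applyUpTo⁺ (fold x σ) (m%n<n j m))

    orbit-unique : Unique (orbit m x)
    orbit-unique = applyUpTo⁺₁ (fold x σ) m distinct
      where
      distinct : ∀ {i j} → i < j → j < m → fold x σ i ≢ fold x σ j
      distinct {i} {j} i<j j<m eq = proj₂ (proj₂ period) (m ∸ j + i) 0<shift shift<m (begin
        fold x σ (m ∸ j + i)            ≡⟨ fold-+ x σ (m ∸ j) ⟩
        fold (fold x σ i) σ (m ∸ j)     ≡⟨ cong (λ y → fold y σ (m ∸ j)) eq ⟩
        fold (fold x σ j) σ (m ∸ j)     ≡⟨ fold-+ x σ (m ∸ j) ⟨
        fold x σ (m ∸ j + j)            ≡⟨ cong (fold x σ) (m∸n+n≡m (<⇒≤ j<m)) ⟩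
        fold x σ m                      ≡⟨ proj₁ (proj₂ period) ⟩
        x                               ∎)
        where
        open ≡-Reasoning
        0<shift : 0 < m ∸ j + i
        0<shift = <-≤-trans (m<n⇒0<n∸m j<m) (m≤m+n (m ∸ j) i)
        shift<m : m ∸ j + i < m
        shift<m = subst (m ∸ j + i <_) (m∸n+n≡m (<⇒≤ j<m)) (+-monoʳ-< (m ∸ j) i<j)

  fold-closed : ∀ {xs} → (∀ {x} → x ∈ xs → σ x ∈ xs) → ∀ j {x} → x ∈ xs → fold x σ j ∈ xs
  fold-closed closed zero    x∈ = x∈
  fold-closed closed (suc j) x∈ = closed (fold-closed closed j x∈)

  module _ (_≟_ : DecidableEquality A) {m : ℕ} where
    open import Data.List.Membership.DecPropositional _≟_ using (_∈?_)

    period∣length : ∀ xs → Unique xs → (∀ {x} → x ∈ xs → σ x ∈ xs) →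
                    (∀ {x} → x ∈ xs → IsLeastPositive (IsPeriodOf x) m) → m ∣ length xs
    period∣length xs = bounded (length xs) xs ≤-refl
      where
      bounded : ∀ k xs → length xs ≤ k → Unique xs → (∀ {x} → x ∈ xs → σ x ∈ xs) →
                (∀ {x} → x ∈ xs → IsLeastPositive (IsPeriodOf x) m) → m ∣ length xs
      bounded _       []           _    _      _      _        = m ∣0
      bounded (suc k) xs@(x ∷ _) len≤ unique closed periodic =
        subst (m ∣_) split (∣m∣n⇒∣m+n ∣-refl (bounded k outside outside-shorter (filter⁺ ∉orbit? unique) outside-closed (periodic ∘ proj₁ ∘ ∈-filter⁻ ∉orbit?)))
        where
        ∈orbit? = _∈? orbit m x
        ∉orbit? = ¬? ∘ ∈orbit?
        inside  = filter ∈orbit? xs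
        outside = filter ∉orbit? xs
        x-period = periodic (here refl)

        orbit⊆ : ∀ {z} → z ∈ orbit m x → z ∈ xs
        orbit⊆ z∈ with ∈-applyUpTo⁻ (fold x σ) z∈
        ... | i , _ , refl = fold-closed closed i (here refl)

        length-inside : length inside ≡ m
        length-inside = trans
          (unique-sameElements⇒length≡ (filter⁺ ∈orbit? unique) (orbit-unique x-period)
            (proj₂ ∘ ∈-filter⁻ ∈orbit?) (λ z∈ → ∈-filter⁺ ∈orbit? (orbit⊆ z∈) z∈))
          (length-applyUpTo (fold x σ) m)

        split : m + length outside ≡ length xs
        split = trans (cong (_+ length outside) (sym length-inside)) (length-filter-split ∈orbit? xs)

        outside-shorter : length outside ≤ k
        outside-shorter = ≤-pred (≤-trans (+-monoˡ-≤ (length outside) (proj₁ x-period)) (subst (_≤ suc k) (sym split) len≤))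

        outside-closed : ∀ {y} → y ∈ outside → σ y ∈ outside
        outside-closed {y} y∈ with ∈-filter⁻ ∉orbit? y∈
        ... | y∈xs , y∉orbit = ∈-filter⁺ ∉orbit? (closed y∈xs) σy∉orbit
          where
          σy∉orbit : ¬ σ y ∈ orbit m x
          σy∉orbit σy∈ with ∈-applyUpTo⁻ (fold x σ) σy∈ | periodic y∈xs
          ... | i , _ , σy≡ | 0<m@(s≤s {n = m-1} _) , y-period , _ = y∉orbit (subst (_∈ orbit m x) (begin
            fold x σ (m-1 + i)           ≡⟨ fold-+ x σ m-1 ⟩
            fold (fold x σ i) σ m-1      ≡⟨ cong (λ z → fold z σ m-1) σy≡ ⟨
            fold (σ y) σ m-1             ≡⟨ fold-suc-inner y m-1 ⟨
            fold y σ m                   ≡⟨ y-period ⟩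
            y                            ∎) (fold∈orbit x-period (m-1 + i)))
            where open ≡-Reasoning

fold-rotate-length : ∀ {A : Set} (xs : List A) → fold xs rotate (length xs) ≡ xs
fold-rotate-length {A} xs = trans (cong (λ ys → fold ys rotate (length xs)) (sym (++-identityʳ xs))) (fold-rotate-++ xs [])
  where
  open Iteration (rotate {A = A}) using (fold-suc-inner)
  fold-rotate-++ : ∀ (xs ys : List A) → fold (xs ++ ys) rotate (length xs) ≡ ys ++ xs
  fold-rotate-++ []       ys = sym (++-identityʳ ys)
  fold-rotate-++ (x ∷ xs) ys = begin
    fold (x ∷ xs ++ ys) rotate (suc (length xs))    ≡⟨ fold-suc-inner (x ∷ xs ++ ys) (length xs) ⟩
    fold ((xs ++ ys) ++ [ x ]) rotate (length xs)   ≡⟨ cong (λ zs → fold zs rotate (length xs)) (++-assoc xs ys [ x ]) ⟩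
    fold (xs ++ ys ++ [ x ]) rotate (length xs)     ≡⟨ fold-rotate-++ xs (ys ++ [ x ]) ⟩
    (ys ++ [ x ]) ++ xs                             ≡⟨ ++-assoc ys [ x ] xs ⟩
    ys ++ x ∷ xs                                    ∎
    where open ≡-Reasoning

-- Finite groups

single-element : ∀ {n} (c : Fin n) → (∀ x → x ≡ c) → n ≡ 1
single-element {suc zero}    _ _   = refl
single-element {suc (suc _)} _ all = contradiction (trans (all zero) (sym (all (suc zero)))) λ ()

module GroupTheory {n : ℕ} (G : FiniteGroup n) where
  open FiniteGroup G

  group : Group 0ℓ 0ℓ
  group = record
    { isGroup = record
      { isMonoid = record
        { isSemigroup = record { isMagma = record { isEquivalence = isEquivalence ; ∙-cong = cong₂ _∙_ } ; assoc = assoc }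
        ; identity    = identityˡ , identityʳ
        }
      ; inverse = inverseˡ , inverseʳ
      ; ⁻¹-cong = cong _⁻¹
      }
    }

  open Algebra.Properties.Group group using (∙-cancelˡ; ∙-cancelʳ; inverseˡ-unique; inverseʳ-unique; ⁻¹-involutive; ⁻¹-anti-homo-∙; ε⁻¹≈ε; ⁻¹-injective)
  open ≡-Reasoning

  pow-+ : ∀ x a b → pow x (a + b) ≡ pow x a ∙ pow x b
  pow-+ x zero    b = sym (identityˡ _)
  pow-+ x (suc a) b = trans (cong (x ∙_) (pow-+ x a b)) (sym (assoc _ _ _))

  pow-* : ∀ x a b → pow x (a * b) ≡ pow (pow x b) a
  pow-* x zero    b = refl
  pow-* x (suc a) b = trans (pow-+ x b (a * b)) (cong (pow x b ∙_) (pow-* x a b))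

  pow-ε : ∀ j → pow ε j ≡ ε
  pow-ε zero    = refl
  pow-ε (suc j) = trans (identityˡ _) (pow-ε j)

  pow-sucʳ : ∀ x j → pow x (suc j) ≡ pow x j ∙ x
  pow-sucʳ x j = trans (cong (pow x) (+-comm 1 j)) (trans (pow-+ x j 1) (cong (pow x j ∙_) (identityʳ x)))

  pow-⁻¹ : ∀ x j → pow (x ⁻¹) j ≡ pow x j ⁻¹
  pow-⁻¹ x zero    = sym ε⁻¹≈ε
  pow-⁻¹ x (suc j) = begin
    x ⁻¹ ∙ pow (x ⁻¹) j   ≡⟨ cong (x ⁻¹ ∙_) (pow-⁻¹ x j) ⟩
    x ⁻¹ ∙ pow x j ⁻¹     ≡⟨ ⁻¹-anti-homo-∙ (pow x j) x ⟨
    (pow x j ∙ x) ⁻¹      ≡⟨ cong _⁻¹ (pow-sucʳ x j) ⟨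
    pow x (suc j) ⁻¹      ∎

  powers-subtractive : ∀ x → IsSubtractiveSubmonoid (λ j → pow x j ≡ ε)
  powers-subtractive x = record
    { 0∈       = refl
    ; +-closed = λ {a} {b} pa pb → trans (pow-+ x a b) (trans (cong₂ _∙_ pa pb) (identityˡ ε))
    ; ∸-closed = λ {a} {b} pab pa → ∙-cancelˡ (pow x a) (pow x b) ε (begin
        pow x a ∙ pow x b   ≡⟨ pow-+ x a b ⟨
        pow x (a + b)       ≡⟨ pab ⟩
        ε                   ≡⟨ inverseʳ ε ⟨
        ε ∙ ε ⁻¹            ≡⟨ cong (_∙ ε ⁻¹) pa ⟨
        pow x a ∙ ε ⁻¹      ≡⟨ cong (pow x a ∙_) ε⁻¹≈ε ⟩
        pow x a ∙ ε         ∎)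
    }

  module _ {x k} (order : IsOrder x k) where
    open IsSubtractiveSubmonoid (powers-subtractive x)

    order∣ : ∀ {a} → pow x a ≡ ε → k ∣ a
    order∣ = leastPositive∣ order

    ∣⇒pow≡ε : ∀ {a} → k ∣ a → pow x a ≡ ε
    ∣⇒pow≡ε (divides c refl) = *-closed c (proj₁ (proj₂ order))

  order-unique : ∀ {x k l} → IsOrder x k → IsOrder x l → k ≡ l
  order-unique = leastPositive-unique

  order-exists : ∀ x → ∃ (IsOrder x)
  order-exists x with pigeonhole (n<1+n n) (λ (i : Fin (suc n)) → pow x (toℕ i))
  ... | i , j , i<j , xⁱ≡xʲ = leastPositive (λ k → pow x k Finₚ.≟ ε) (toℕ j ∸ toℕ i) (m<n⇒0<n∸m i<j)
    (∙-cancelʳ (pow x (toℕ i)) _ _ (begin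
      pow x (toℕ j ∸ toℕ i) ∙ pow x (toℕ i)   ≡⟨ pow-+ x (toℕ j ∸ toℕ i) (toℕ i) ⟨
      pow x (toℕ j ∸ toℕ i + toℕ i)           ≡⟨ cong (pow x) (m∸n+n≡m (<⇒≤ i<j)) ⟩
      pow x (toℕ j)                           ≡⟨ xⁱ≡xʲ ⟨
      pow x (toℕ i)                           ≡⟨ identityˡ _ ⟨
      ε ∙ pow x (toℕ i)                       ∎))

  order-ε : IsOrder ε 1
  order-ε = s≤s z≤n , identityˡ ε , λ j 0<j j<1 _ → <⇒≱ 0<j (≤-pred j<1)

  ≢ε⇒1<order : ∀ {x m} → IsOrder x m → x ≢ ε → 1 < m
  ≢ε⇒1<order (0<m , xᵐ≡ε , _) x≢ε = ≤∧≢⇒< 0<m λ { refl → x≢ε (trans (sym (identityʳ _)) xᵐ≡ε) }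

  order-pow : ∀ {x m} → IsOrder x m → ∀ a {d} → a * d ≡ m → IsOrder (pow x a) d
  order-pow {x} {m} order@(0<m , xᵐ≡ε , _) a {d} a*d≡m = 0<d , xᵃᵈ≡ε , minimal
    where
    instance
      a≢0 : NonZero a
      a≢0 = ≢-nonZero λ { refl → <⇒≢ 0<m a*d≡m }
    0<d : 0 < d
    0<d = n≢0⇒n>0 λ { refl → <⇒≢ 0<m (trans (sym (*-zeroʳ a)) a*d≡m) }
    xᵃᵈ≡ε : pow (pow x a) d ≡ ε
    xᵃᵈ≡ε = trans (sym (pow-* x d a)) (trans (cong (pow x) (trans (*-comm d a) a*d≡m)) xᵐ≡ε)
    minimal : ∀ j → 0 < j → j < d → pow (pow x a) j ≢ ε
    minimal j 0<j j<d xᵃʲ≡ε = <⇒≱ j<d (∣⇒≤ {{>-nonZero 0<j}} (*-cancelˡ-∣ a (subst (_∣ a * j) (sym a*d≡m)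
      (order∣ order (trans (cong (pow x) (*-comm a j)) (trans (pow-* x j a) xᵃʲ≡ε))))))

  order-⁻¹ : ∀ {x m} → IsOrder x m → IsOrder (x ⁻¹) m
  order-⁻¹ {x} = leastPositive-resp-⇔ λ j → mk⇔
    (λ xʲ≡ε → trans (pow-⁻¹ x j) (trans (cong _⁻¹ xʲ≡ε) ε⁻¹≈ε))
    (λ x⁻ʲ≡ε → ⁻¹-injective (trans (sym (pow-⁻¹ x j)) (trans x⁻ʲ≡ε (sym ε⁻¹≈ε))))

  lagrange : ∀ {x m} → IsOrder x m → m ∣ n
  lagrange {x} {m} order =
    subst (m ∣_) (length-tabulate {n = n} id) (period∣length Finₚ._≟_ (allFin n) (allFin⁺ n) (λ _ → ∈-allFin _) period)
    where
    open Iteration (x ∙_)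
    fold≡pow∙ : ∀ j g → fold g (x ∙_) j ≡ pow x j ∙ g
    fold≡pow∙ zero    g = sym (identityˡ g)
    fold≡pow∙ (suc j) g = trans (cong (x ∙_) (fold≡pow∙ j g)) (sym (assoc _ _ _))
    period : ∀ {g} → g ∈ allFin n → IsLeastPositive (IsPeriodOf g) m
    period {g} _ = leastPositive-resp-⇔ (λ j → mk⇔
      (λ xʲ≡ε → trans (fold≡pow∙ j g) (trans (cong (_∙ g) xʲ≡ε) (identityˡ g)))
      (λ xʲg≡g → ∙-cancelʳ g _ _ (trans (sym (fold≡pow∙ j g)) (trans xʲg≡g (sym (identityˡ g)))))) order

  Commute : Fin n → Fin n → Set
  Commute a b = a ∙ b ≡ b ∙ a

  commute-powˡ : ∀ {a b} → Commute a b → ∀ j → Commute (pow a j) b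
  commute-powˡ {a} {b} ab≡ba zero    = trans (identityˡ b) (sym (identityʳ b))
  commute-powˡ {a} {b} ab≡ba (suc j) = begin
    (a ∙ pow a j) ∙ b   ≡⟨ assoc _ _ _ ⟩
    a ∙ (pow a j ∙ b)   ≡⟨ cong (a ∙_) (commute-powˡ ab≡ba j) ⟩
    a ∙ (b ∙ pow a j)   ≡⟨ assoc _ _ _ ⟨
    (a ∙ b) ∙ pow a j   ≡⟨ cong (_∙ pow a j) ab≡ba ⟩
    (b ∙ a) ∙ pow a j   ≡⟨ assoc _ _ _ ⟩
    b ∙ (a ∙ pow a j)   ∎

  pow-∙ : ∀ {a b} → Commute a b → ∀ j → pow (a ∙ b) j ≡ pow a j ∙ pow b j
  pow-∙ {a} {b} ab≡ba zero    = sym (identityˡ ε)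
  pow-∙ {a} {b} ab≡ba (suc j) = begin
    (a ∙ b) ∙ pow (a ∙ b) j           ≡⟨ cong ((a ∙ b) ∙_) (pow-∙ ab≡ba j) ⟩
    (a ∙ b) ∙ (pow a j ∙ pow b j)     ≡⟨ assoc _ _ _ ⟩
    a ∙ (b ∙ (pow a j ∙ pow b j))     ≡⟨ cong (a ∙_) (assoc _ _ _) ⟨
    a ∙ ((b ∙ pow a j) ∙ pow b j)     ≡⟨ cong (λ c → a ∙ (c ∙ pow b j)) (commute-powˡ ab≡ba j) ⟨
    a ∙ ((pow a j ∙ b) ∙ pow b j)     ≡⟨ cong (a ∙_) (assoc _ _ _) ⟩
    a ∙ (pow a j ∙ (b ∙ pow b j))     ≡⟨ assoc _ _ _ ⟨
    (a ∙ pow a j) ∙ (b ∙ pow b j)     ∎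

  prime∣order-∙ : ∀ {a b p q M} → Commute a b → IsOrder a p → IsOrder b q → IsOrder (a ∙ b) M →
                  Prime p → ¬ p ∣ q → p ∣ M
  prime∣order-∙ {a} {b} {p} {q} {M} ab≡ba order-a order-b order-ab p-prime p∤q =
    [ id , flip contradiction p∤q ]′ (euclidsLemma M q p-prime (order∣ order-a aᴹᑫ≡ε))
    where
    aᴹᑫ≡ε : pow a (M * q) ≡ ε
    aᴹᑫ≡ε = begin
      pow a (M * q)                     ≡⟨ identityʳ _ ⟨
      pow a (M * q) ∙ ε                 ≡⟨ cong (pow a (M * q) ∙_) (∣⇒pow≡ε order-b (n∣m*n M)) ⟨
      pow a (M * q) ∙ pow b (M * q)     ≡⟨ pow-∙ ab≡ba (M * q) ⟨
      pow (a ∙ b) (M * q)               ≡⟨ ∣⇒pow≡ε order-ab (m∣m*n q) ⟩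
      ε                                 ∎

  comm≡ε⇒commute : ∀ x g → comm x g ≡ ε → Commute x g
  comm≡ε⇒commute x g [x,g]≡ε = begin
    x ∙ g             ≡⟨ inverseʳ-unique ((g ∙ x) ⁻¹) (x ∙ g) (begin
      (g ∙ x) ⁻¹ ∙ (x ∙ g)          ≡⟨ cong (_∙ (x ∙ g)) (⁻¹-anti-homo-∙ g x) ⟩
      (x ⁻¹ ∙ g ⁻¹) ∙ (x ∙ g)       ≡⟨ assoc _ _ _ ⟨
      comm x g                      ≡⟨ [x,g]≡ε ⟩
      ε                             ∎) ⟩
    (g ∙ x) ⁻¹ ⁻¹     ≡⟨ ⁻¹-involutive (g ∙ x) ⟩
    g ∙ x             ∎

  upperCentral⇒central : ∀ i {x} → Z i x → x ≢ ε → ∃[ z ] z ≢ ε × (∀ g → Commute z g)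
  upperCentral⇒central zero    x≡ε x≢ε = contradiction x≡ε x≢ε
  upperCentral⇒central (suc i) {x} x∈Zᵢ₊₁ x≢ε with Finₚ.any? (λ g → ¬? (comm x g Finₚ.≟ ε))
  ... | yes (g , [x,g]≢ε) = upperCentral⇒central i (x∈Zᵢ₊₁ g) [x,g]≢ε
  ... | no  ∄g            = x , x≢ε , λ g → comm≡ε⇒commute x g (decidable-stable (comm x g Finₚ.≟ ε) (∄g ∘ (g ,_)))

  nilpotent⇒centralOfPrimeOrder : IsNilpotent G → ∀ {x} → x ≢ ε →
                                  ∃[ z ] ∃[ p ] Prime p × IsOrder z p × (∀ g → Commute z g)
  nilpotent⇒centralOfPrimeOrder (class , all∈Z) {x} x≢ε with upperCentral⇒central class (all∈Z x) x≢ε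
  ... | z , z≢ε , central with order-exists z
  ...   | m , order-z with ∃primeDivisor m (≢ε⇒1<order order-z z≢ε)
  ...     | p , p-prime , divides c m≡cp =
    pow z c , p , p-prime , order-pow order-z c (sym m≡cp) , λ g → commute-powˡ (central g) c

  pow≡ε⇒order≡prime : ∀ {x q} → Prime q → pow x q ≡ ε → x ≢ ε → IsOrder x q
  pow≡ε⇒order≡prime {x} q-prime xᵠ≡ε x≢ε =
    IsSubtractiveSubmonoid.prime⇒leastPositive (powers-subtractive x) (λ j → pow x j Finₚ.≟ ε) q-prime xᵠ≡ε
      (x≢ε ∘ trans (sym (identityʳ x)))

  prod : List (Fin n) → Fin n
  prod = foldr _∙_ ε

  prod-replicate : ∀ j x → prod (replicate j x) ≡ pow x j
  prod-replicate zero    x = refl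
  prod-replicate (suc j) x = cong (x ∙_) (prod-replicate j x)

  prod-rotate : ∀ xs → prod xs ≡ ε → prod (rotate xs) ≡ ε
  prod-rotate []       xs≡ε      = xs≡ε
  prod-rotate (x ∷ xs) x∙xs≡ε = begin
    prod (xs ∷ʳ x)        ≡⟨ prod-∷ʳ xs ⟩
    prod xs ∙ x           ≡⟨ cong (_∙ x) (inverseʳ-unique x (prod xs) x∙xs≡ε) ⟩
    x ⁻¹ ∙ x              ≡⟨ inverseˡ x ⟩
    ε                     ∎
    where
    prod-∷ʳ : ∀ ys → prod (ys ∷ʳ x) ≡ prod ys ∙ x
    prod-∷ʳ []       = trans (identityʳ x) (sym (identityˡ x))
    prod-∷ʳ (y ∷ ys) = trans (cong (y ∙_) (prod-∷ʳ ys)) (sym (assoc _ _ _))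

  -- The words of length k + 1 with product ε, each listed via its last k letters, which determine it.
  balanced : ℕ → List (List (Fin n))
  balanced k = map (λ xs → prod xs ⁻¹ ∷ xs) (words (allFin n) k)

  length-balanced : ∀ k → length (balanced k) ≡ n ^ k
  length-balanced k = begin
    length (balanced k)              ≡⟨ length-map _ (words (allFin n) k) ⟩
    length (words (allFin n) k)      ≡⟨ length-words (allFin n) k ⟩
    length (allFin n) ^ k            ≡⟨ cong (_^ k) (length-tabulate {n = n} id) ⟩
    n ^ k                            ∎

  balanced-unique : ∀ k → Unique (balanced k)
  balanced-unique k = map⁺ (proj₂ ∘ ∷-injective) (words-unique (allFin⁺ n) k)

  ∈-balanced⁺ : ∀ {k xs} → length xs ≡ suc k → prod xs ≡ ε → xs ∈ balanced k
  ∈-balanced⁺ {xs = x ∷ xs} refl x∙xs≡ε =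
    subst (λ y → y ∷ xs ∈ balanced (length xs)) (sym (inverseˡ-unique x (prod xs) x∙xs≡ε))
      (∈-map⁺ _ (∈-words⁺ (All.universal ∈-allFin xs)))

  ∈-balanced⁻ : ∀ {k xs} → xs ∈ balanced k → length xs ≡ suc k × prod xs ≡ ε
  ∈-balanced⁻ {k} xs∈ with ∈-map⁻ _ xs∈
  ... | ys , ys∈ , refl = cong suc (∈-words⁻ k ys∈) , inverseˡ (prod ys)

  -- McKay's proof: rotation permutes the balanced words of length q; the non-constant ones fall
  -- into orbits of size q, and q divides nᵠ⁻¹, so q divides the number of constant balanced words.
  module McKay {k : ℕ} (q-prime : Prime (suc (suc k))) (q∣n : suc (suc k) ∣ n) where
    q : ℕ
    q = suc (suc k)
    open Iteration (rotate {A = Fin n})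

    _≟ʷ_ : DecidableEquality (List (Fin n))
    _≟ʷ_ = ≡-dec Finₚ._≟_

    Fixed? : Decidable (λ v → rotate v ≡ v)
    Fixed? v = rotate v ≟ʷ v

    fixed moving : List (List (Fin n))
    fixed  = filter Fixed? (balanced (suc k))
    moving = filter (¬? ∘ Fixed?) (balanced (suc k))

    ∈-fixed⁻ : ∀ {v} → v ∈ fixed → v ∈ balanced (suc k) × rotate v ≡ v
    ∈-fixed⁻ = ∈-filter⁻ Fixed? {xs = balanced (suc k)}

    ∈-moving⁻ : ∀ {v} → v ∈ moving → v ∈ balanced (suc k) × rotate v ≢ v
    ∈-moving⁻ = ∈-filter⁻ (¬? ∘ Fixed?) {xs = balanced (suc k)}

    moving-closed : ∀ {v} → v ∈ moving → rotate v ∈ moving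
    moving-closed {v} v∈ with ∈-moving⁻ v∈
    ... | v∈X , v-moves with ∈-balanced⁻ {suc k} v∈X
    ...   | |v|≡q , v≡ε = ∈-filter⁺ (¬? ∘ Fixed?)
                            (∈-balanced⁺ (trans (length-rotate v) |v|≡q) (prod-rotate v v≡ε)) (v-moves ∘ rotate-injective)

    moving-period : ∀ {v} → v ∈ moving → IsLeastPositive (IsPeriodOf v) q
    moving-period {v} v∈ with ∈-moving⁻ v∈
    ... | v∈X , v-moves = IsSubtractiveSubmonoid.prime⇒leastPositive (periods-subtractive v) (λ j → fold v rotate j ≟ʷ v)
                            q-prime (subst (IsPeriodOf v) (proj₁ (∈-balanced⁻ {suc k} v∈X)) (fold-rotate-length v)) v-moves

    q∣balanced : q ∣ length (balanced (suc k))
    q∣balanced = subst (q ∣_) (sym (length-balanced (suc k))) (∣m⇒∣m*n (n ^ k) q∣n)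

    q∣moving : q ∣ length moving
    q∣moving = period∣length _≟ʷ_ moving (filter⁺ _ (balanced-unique (suc k))) moving-closed moving-period

    q∣fixed : q ∣ length fixed
    q∣fixed = ∣m+n∣m⇒∣n (subst (q ∣_) (sym split) q∣balanced) q∣moving
      where
      split : length moving + length fixed ≡ length (balanced (suc k))
      split = trans (+-comm (length moving) _) (length-filter-split Fixed? (balanced (suc k)))

    ε-word : List (Fin n)
    ε-word = replicate q ε

    ε-word∈fixed : ε-word ∈ fixed
    ε-word∈fixed = ∈-filter⁺ Fixed? (∈-balanced⁺ (length-replicate q) (trans (prod-replicate q ε) (pow-ε q))) (rotate-replicate q ε)

    fixed⇒constant : ∀ {v} → v ∈ fixed → ∃[ x ] v ≡ replicate q x
    fixed⇒constant {[]}     v∈ with () ← proj₁ (∈-balanced⁻ {suc k} (proj₁ (∈-fixed⁻ v∈)))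
    fixed⇒constant {x ∷ xs} v∈ with ∈-fixed⁻ v∈
    ... | v∈X , v-fixed = x , trans (rotate-fixed⇒replicate x xs v-fixed) (cong (λ l → replicate l x) (proj₁ (∈-balanced⁻ {suc k} v∈X)))

    ∃fixed≢ε-word : ∃[ v ] v ∈ fixed × v ≢ ε-word
    ∃fixed≢ε-word = unique⇒∃≢ _≟ʷ_ (filter⁺ Fixed? (balanced-unique (suc k))) 2≤|fixed| ε-word
      where
      2≤|fixed| : 2 ≤ length fixed
      2≤|fixed| = ≤-trans (s≤s (s≤s z≤n)) (∣⇒≤ {{>-nonZero (∈-length ε-word∈fixed)}} q∣fixed)

    elementOfOrder-q : ∃[ x ] IsOrder x q
    elementOfOrder-q = constant⇒order ∃fixed≢ε-word
      where
      constant⇒order : ∃[ v ] v ∈ fixed × v ≢ ε-word → ∃[ x ] IsOrder x q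
      constant⇒order (v , v∈ , v≢ε-word) with fixed⇒constant v∈
      ... | x , refl = x , pow≡ε⇒order≡prime q-prime xᵠ≡ε (λ { refl → v≢ε-word refl })
        where
        xᵠ≡ε : pow x q ≡ ε
        xᵠ≡ε = trans (sym (prod-replicate q x)) (proj₂ (∈-balanced⁻ {suc k} (proj₁ (∈-fixed⁻ v∈))))

  cauchy : ∀ {q} → Prime q → q ∣ n → ∃[ x ] IsOrder x q
  cauchy {zero}        q-prime = contradiction q-prime ¬prime[0]
  cauchy {suc zero}    q-prime = contradiction q-prime ¬prime[1]
  cauchy {suc (suc k)} q-prime q∣n = McKay.elementOfOrder-q q-prime q∣n

  record MixedOrderElement : Set where
    field
      {w}        : Fin n
      {M p q}    : ℕ
      order      : IsOrder w M
      p-prime    : Prime p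
      q-prime    : Prime q
      p≢q        : p ≢ q
      p∣M        : p ∣ M
      q∣M        : q ∣ M

  commuting⇒mixedOrder : ∀ {a b p q} → Commute a b → IsOrder a p → IsOrder b q → Prime p → Prime q → p ≢ q →
                          MixedOrderElement
  commuting⇒mixedOrder {a} {b} ab≡ba order-a order-b p-prime q-prime p≢q with order-exists (a ∙ b)
  ... | M , order-ab = record
    { order   = order-ab
    ; p-prime = p-prime
    ; q-prime = q-prime
    ; p≢q     = p≢q
    ; p∣M     = prime∣order-∙ ab≡ba order-a order-b order-ab p-prime (prime∤prime p-prime q-prime p≢q)
    ; q∣M     = prime∣order-∙ (sym ab≡ba) order-b order-a (subst (λ c → IsOrder c M) ab≡ba order-ab) q-prime
                              (prime∤prime q-prime p-prime (p≢q ∘ sym))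
    }

  centralOfPrimeOrder⇒pGroup⊎mixedOrder : (∃[ z ] ∃[ p ] Prime p × IsOrder z p × (∀ g → Commute z g)) →
                                          IsPGroup G ⊎ MixedOrderElement
  centralOfPrimeOrder⇒pGroup⊎mixedOrder (z , p , p-prime , order-z , central) =
    Sum.map (λ n≡pᵏ → p , p-prime , n≡pᵏ) otherPrime⇒mixedOrder (power⊎otherPrimeDivisor p-prime n {{Finₚ.nonZeroIndex z}})
    where
    otherPrime⇒mixedOrder : ∃[ q ] Prime q × q ≢ p × q ∣ n → MixedOrderElement
    otherPrime⇒mixedOrder (q , q-prime , q≢p , q∣n) =
      commuting⇒mixedOrder (central _) order-z (proj₂ (cauchy q-prime q∣n)) p-prime q-prime (q≢p ∘ sym)

  nilpotent⇒pGroup⊎mixedOrder : IsNilpotent G → IsPGroup G ⊎ MixedOrderElement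
  nilpotent⇒pGroup⊎mixedOrder nilpotent with Finₚ.any? (λ x → ¬? (x Finₚ.≟ ε))
  ... | no  ∄x≢ε      = inj₁ (2 , prime[2] , 0 , single-element ε (λ x → decidable-stable (x Finₚ.≟ ε) (∄x≢ε ∘ (x ,_))))
  ... | yes (x , x≢ε) = centralOfPrimeOrder⇒pGroup⊎mixedOrder (nilpotent⇒centralOfPrimeOrder nilpotent x≢ε)

-- Line graphs

record K5MinusEdge {A : Set} (R : A → A → Set) : Set where
  field
    u v w₁ w₂ w₃ : A
    u≢v : u ≢ v
    u≁v : ¬ R u v
    u∼w₁ : R u w₁
    u∼w₂ : R u w₂
    u∼w₃ : R u w₃
    v∼w₁ : R v w₁
    v∼w₂ : R v w₂
    v∼w₃ : R v w₃
    w₁∼w₂ : R w₁ w₂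
    w₁∼w₃ : R w₁ w₃
    w₂∼w₃ : R w₂ w₃

K5MinusEdge-embed : ∀ {A B : Set} {R : A → A → Set} {S : B → B → Set} (f : A → B) →
                    (∀ {x y} → f x ≡ f y → x ≡ y) → (∀ x y → R x y ⇔ S (f x) (f y)) →
                    K5MinusEdge R → K5MinusEdge S
K5MinusEdge-embed f f-injective R⇔S k = record
  { u = f u ; v = f v ; w₁ = f w₁ ; w₂ = f w₂ ; w₃ = f w₃
  ; u≢v = u≢v ∘ f-injective ; u≁v = u≁v ∘ from (R⇔S u v)
  ; u∼w₁ = to (R⇔S _ _) u∼w₁ ; u∼w₂ = to (R⇔S _ _) u∼w₂ ; u∼w₃ = to (R⇔S _ _) u∼w₃
  ; v∼w₁ = to (R⇔S _ _) v∼w₁ ; v∼w₂ = to (R⇔S _ _) v∼w₂ ; v∼w₃ = to (R⇔S _ _) v∼w₃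
  ; w₁∼w₂ = to (R⇔S _ _) w₁∼w₂ ; w₁∼w₃ = to (R⇔S _ _) w₁∼w₃ ; w₂∼w₃ = to (R⇔S _ _) w₂∼w₃
  }
  where open K5MinusEdge k

Square-adjacent : Bool × Bool → Bool × Bool → Set
Square-adjacent x y = x ≢ y × (proj₁ x ≡ proj₁ y ⊎ proj₂ x ≡ proj₂ y)

square-triangleFree : ∀ {x y z} → Square-adjacent x y → Square-adjacent x z → Square-adjacent y z → ⊥
square-triangleFree x∼y x∼z y∼z = noThreeDistinct (parity-flips x∼y) (parity-flips x∼z) (parity-flips y∼z)
  where
  parity : Bool × Bool → Bool
  parity (α , β) = α xor β

  xor-injectiveʳ : ∀ α {β β'} → α xor β ≡ α xor β' → β ≡ β'
  xor-injectiveʳ false eq = eq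
  xor-injectiveʳ true  eq = not-injective eq

  parity-flips : ∀ {x y} → Square-adjacent x y → parity x ≢ parity y
  parity-flips {α , β} {.α , β'} (x≢y , inj₁ refl) eq = x≢y (cong (α ,_) (xor-injectiveʳ α eq))
  parity-flips {α , β} {α' , .β} (x≢y , inj₂ refl) eq =
    x≢y (cong (_, β) (xor-injectiveʳ β (trans (xor-comm β α) (trans eq (xor-comm α' β)))))

  noThreeDistinct : ∀ {a b c : Bool} → a ≢ b → a ≢ c → b ≢ c → ⊥
  noThreeDistinct {false} {false}         a≢b _   _   = a≢b refl
  noThreeDistinct {true}  {true}          a≢b _   _   = a≢b refl
  noThreeDistinct {false} {true}  {false} _   a≢c _   = a≢c refl
  noThreeDistinct {false} {true}  {true}  _   _   b≢c = b≢c refl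
  noThreeDistinct {true}  {false} {false} _   _   b≢c = b≢c refl
  noThreeDistinct {true}  {false} {true}  _   a≢c _   = a≢c refl

module LineGraph {m : ℕ} (Γ : SimpleGraph m) where

  Meet : Fin m × Fin m → Fin m × Fin m → Set
  Meet (a , b) (c , d) = a ≡ c ⊎ a ≡ d ⊎ b ≡ c ⊎ b ≡ d

  _∈ₑ_ : Fin m → Fin m × Fin m → Set
  x ∈ₑ (s , t) = x ≡ s ⊎ x ≡ t

  end : Fin m × Fin m → Bool → Fin m
  end (a , _) true  = a
  end (_ , b) false = b

  end-injective : ∀ {a b} → a ≢ b → ∀ {α α'} → end (a , b) α ≡ end (a , b) α' → α ≡ α'
  end-injective a≢b {true}  {true}  _ = refl
  end-injective a≢b {false} {false} _ = refl
  end-injective a≢b {true}  {false} a≡b = contradiction a≡b a≢b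
  end-injective a≢b {false} {true}  b≡a = contradiction (sym b≡a) a≢b

  meet⇒∃end : ∀ {e f} → Meet e f → ∃[ α ] end e α ∈ₑ f
  meet⇒∃end (inj₁ a≡c)               = true  , inj₁ a≡c
  meet⇒∃end (inj₂ (inj₁ a≡d))        = true  , inj₂ a≡d
  meet⇒∃end (inj₂ (inj₂ (inj₁ b≡c))) = false , inj₁ b≡c
  meet⇒∃end (inj₂ (inj₂ (inj₂ b≡d))) = false , inj₂ b≡d

  edge-≡ : ∀ {e f : Edge Γ} → proj₁ e ≡ proj₁ f → e ≡ f
  edge-≡ {_ , s<t , st} {_ , s<t' , st'} refl = cong (λ p → _ , p) (cong₂ _,_ (Finₚ.<-irrelevant s<t s<t') (T-irrelevant st st'))

  -- An edge meeting two disjoint edges {a, b} and {c, d} is {end (a , b) α, end (c , d) β} for some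
  -- point (α , β) of the square Bool × Bool, and distinct such edges that meet give adjacent points.
  module Transversals {ab cd : Fin m × Fin m} (ab-proper : proj₁ ab ≢ proj₂ ab) (cd-proper : proj₁ cd ≢ proj₂ cd)
                      (disjoint : ¬ Meet ab cd) where

    Crosses : Bool × Bool → Fin m × Fin m → Set
    Crosses (α , β) (s , t) = (end ab α ≡ s × end cd β ≡ t) ⊎ (end ab α ≡ t × end cd β ≡ s)

    ends-distinct : ∀ α β → end ab α ≢ end cd β
    ends-distinct true  true  a≡c = disjoint (inj₁ a≡c)
    ends-distinct true  false a≡d = disjoint (inj₂ (inj₁ a≡d))
    ends-distinct false true  b≡c = disjoint (inj₂ (inj₂ (inj₁ b≡c)))
    ends-distinct false false b≡d = disjoint (inj₂ (inj₂ (inj₂ b≡d)))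

    classify : ∀ {e} → Meet ab e → Meet cd e → ∃[ αβ ] Crosses αβ e
    classify meet-ab meet-cd with meet⇒∃end meet-ab | meet⇒∃end meet-cd
    ... | α , inj₁ a≡s | β , inj₂ c≡t = (α , β) , inj₁ (a≡s , c≡t)
    ... | α , inj₂ a≡t | β , inj₁ c≡s = (α , β) , inj₂ (a≡t , c≡s)
    ... | α , inj₁ a≡s | β , inj₁ c≡s = contradiction (trans a≡s (sym c≡s)) (ends-distinct α β)
    ... | α , inj₂ a≡t | β , inj₂ c≡t = contradiction (trans a≡t (sym c≡t)) (ends-distinct α β)

    crosses-∈ₑ : ∀ {α β e x} → Crosses (α , β) e → x ∈ₑ e → x ≡ end ab α ⊎ x ≡ end cd β
    crosses-∈ₑ (inj₁ (refl , refl)) (inj₁ x≡s) = inj₁ x≡s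
    crosses-∈ₑ (inj₁ (refl , refl)) (inj₂ x≡t) = inj₂ x≡t
    crosses-∈ₑ (inj₂ (refl , refl)) (inj₁ x≡s) = inj₂ x≡s
    crosses-∈ₑ (inj₂ (refl , refl)) (inj₂ x≡t) = inj₁ x≡t

    crosses-meet : ∀ {α β α' β' e f} → Crosses (α , β) e → Crosses (α' , β') f → Meet e f → α ≡ α' ⊎ β ≡ β'
    crosses-meet {α} {β} {α'} {β'} {e} {f} cross cross' meet with meet⇒∃end {e} meet
    ... | γ , x∈f with crosses-∈ₑ {α} {β} cross (∈ₑ-end γ) | crosses-∈ₑ {α'} {β'} cross' x∈f
      where
      ∈ₑ-end : ∀ {e} γ → end e γ ∈ₑ e
      ∈ₑ-end true  = inj₁ refl
      ∈ₑ-end false = inj₂ refl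
    ... | inj₁ x≡a | inj₁ x≡a' = inj₁ (end-injective ab-proper (trans (sym x≡a) x≡a'))
    ... | inj₂ x≡c | inj₂ x≡c' = inj₂ (end-injective cd-proper (trans (sym x≡c) x≡c'))
    ... | inj₁ x≡a | inj₂ x≡c' = contradiction (trans (sym x≡a) x≡c') (ends-distinct α β')
    ... | inj₂ x≡c | inj₁ x≡a' = contradiction (trans (sym x≡a') x≡c) (ends-distinct α' β)

    crosses-unique : ∀ {αβ s t s' t'} → s Fin.< t → s' Fin.< t' → Crosses αβ (s , t) → Crosses αβ (s' , t') → (s , t) ≡ (s' , t')
    crosses-unique _   _     (inj₁ (refl , refl)) (inj₁ (refl , refl)) = refl
    crosses-unique _   _     (inj₂ (refl , refl)) (inj₂ (refl , refl)) = refl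
    crosses-unique s<t s'<t' (inj₁ (refl , refl)) (inj₂ (refl , refl)) = contradiction s'<t' (<-asym s<t)
    crosses-unique s<t s'<t' (inj₂ (refl , refl)) (inj₁ (refl , refl)) = contradiction s'<t' (<-asym s<t)

    crosses-adjacent : ∀ {αβ αβ'} {e f : Edge Γ} → Crosses αβ (proj₁ e) → Crosses αβ' (proj₁ f) → LAdj Γ e f → Square-adjacent αβ αβ'
    crosses-adjacent {αβ} {e = _ , s<t , _} {f = _ , s'<t' , _} cross cross' (e≢f , meet) =
      (λ { refl → e≢f (crosses-unique {αβ} s<t s'<t' cross cross') }) , crosses-meet cross cross' meet

  noK5MinusEdge : ¬ K5MinusEdge (LAdj Γ)
  noK5MinusEdge k = square-triangleFree (adjacent w₁ w₂ u∼w₁ v∼w₁ u∼w₂ v∼w₂ w₁∼w₂) (adjacent w₁ w₃ u∼w₁ v∼w₁ u∼w₃ v∼w₃ w₁∼w₃)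
                                        (adjacent w₂ w₃ u∼w₂ v∼w₂ u∼w₃ v∼w₃ w₂∼w₃)
    where
    open K5MinusEdge k
    open Transversals {proj₁ u} {proj₁ v} (Finₚ.<⇒≢ (proj₁ (proj₂ u))) (Finₚ.<⇒≢ (proj₁ (proj₂ v))) (λ meet → u≁v (u≢v ∘ edge-≡ , meet))

    point : ∀ w → LAdj Γ u w → LAdj Γ v w → ∃[ αβ ] Crosses αβ (proj₁ w)
    point w u∼w v∼w = classify {proj₁ w} (proj₂ u∼w) (proj₂ v∼w)

    adjacent : ∀ w w' (u∼w : LAdj Γ u w) (v∼w : LAdj Γ v w) (u∼w' : LAdj Γ u w') (v∼w' : LAdj Γ v w') →
               LAdj Γ w w' → Square-adjacent (proj₁ (point w u∼w v∼w)) (proj₁ (point w' u∼w' v∼w'))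
    adjacent w w' u∼w v∼w u∼w' v∼w' = crosses-adjacent {e = w} {f = w'} (proj₂ (point w u∼w v∼w)) (proj₂ (point w' u∼w' v∼w'))

star : ∀ n → SimpleGraph (suc n)
star n = record { adj = adj ; sym = sym-adj ; irrefl = irrefl-adj }
  where
  adj : Fin (suc n) → Fin (suc n) → Bool
  adj zero    (suc _) = true
  adj (suc _) zero    = true
  adj _       _       = false
  sym-adj : ∀ u v → adj u v ≡ adj v u
  sym-adj zero    zero    = refl
  sym-adj zero    (suc _) = refl
  sym-adj (suc _) zero    = refl
  sym-adj (suc _) (suc _) = refl
  irrefl-adj : ∀ u → ¬ T (adj u u)
  irrefl-adj zero    ()
  irrefl-adj (suc _) ()

module _ {n : ℕ} where

  leaf : Fin n → Edge (star n)
  leaf x = (zero , suc x) , s≤s z≤n , _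

  leaf↔edge : Fin n ↔ Edge (star n)
  leaf↔edge = mk↔ₛ′ leaf centreless (λ e → leaf-centreless e) (λ _ → refl)
    where
    centreless : Edge (star n) → Fin n
    centreless ((_ , suc x) , _) = x
    leaf-centreless : ∀ e → leaf (centreless e) ≡ e
    leaf-centreless ((zero , suc x) , _)      = LineGraph.edge-≡ (star n) refl
    leaf-centreless ((suc _ , suc _) , _ , ())

  LAdj-leaf : ∀ {x y} → x ≢ y → LAdj (star n) (leaf x) (leaf y)
  LAdj-leaf x≢y = (λ { refl → x≢y refl }) , inj₁ refl

complete⇒isLineGraphS : ∀ {n} (G : FiniteGroup n) → (∀ {x y} → x ≢ y → SAdj G x y) → IsLineGraphS G
complete⇒isLineGraphS {n} G complete = suc n , star n , leaf↔edge , λ x y →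
  mk⇔ (LAdj-leaf ∘ proj₁) (λ (leafx≢leafy , _) → complete λ { refl → leafx≢leafy refl })

-- The order supergraph

module OrderSupergraph {n : ℕ} (G : FiniteGroup n) where
  open FiniteGroup G
  open GroupTheory G

  ∼-byOrders : ∀ {x y k l} → IsOrder x k → IsOrder y l → x ≢ y → k ∣ l ⊎ l ∣ k → SAdj G x y
  ∼-byOrders order-x order-y x≢y k|l = x≢y , _ , _ , order-x , order-y , k|l

  order≢⇒≢ : ∀ {x y k l} → IsOrder x k → IsOrder y l → k ≢ l → x ≢ y
  order≢⇒≢ order-x order-y k≢l refl = k≢l (order-unique order-x order-y)

  pGroup⇒complete : IsPGroup G → ∀ {x y} → x ≢ y → SAdj G x y
  pGroup⇒complete (p , p-prime , k , n≡pᵏ) {x} {y} x≢y with order-exists x | order-exists y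
  ... | kx , order-x | ky , order-y with ∣power⇒power p-prime k (subst (kx ∣_) n≡pᵏ (lagrange order-x))
                                       | ∣power⇒power p-prime k (subst (ky ∣_) n≡pᵏ (lagrange order-y))
  ...   | i , refl | j , refl = ∼-byOrders order-x order-y x≢y (Sum.map (power∣power p) (power∣power p) (≤-total i j))

  mixedOrder⇒K5MinusEdge : MixedOrderElement → K5MinusEdge (SAdj G)
  mixedOrder⇒K5MinusEdge record { w = w ; M = M ; p = p ; q = q ; order = order-w ; p-prime = p-prime ; q-prime = q-prime
                                ; p≢q = p≢q ; p∣M = p∣M@(divides a M≡ap) ; q∣M = q∣M@(divides b M≡bq) } = record
    { u = pow w a ; v = pow w b ; w₁ = ε ; w₂ = w ; w₃ = w ⁻¹
    ; u≢v = order≢⇒≢ order-u order-v p≢q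
    ; u≁v = u≁v
    ; u∼w₁ = ∼-byOrders order-u order-ε (order≢⇒≢ order-u order-ε p≢1) (inj₂ (1∣ p))
    ; u∼w₂ = ∼-byOrders order-u order-w (order≢⇒≢ order-u order-w p≢M) (inj₁ p∣M)
    ; u∼w₃ = ∼-byOrders order-u order-w⁻¹ (order≢⇒≢ order-u order-w⁻¹ p≢M) (inj₁ p∣M)
    ; v∼w₁ = ∼-byOrders order-v order-ε (order≢⇒≢ order-v order-ε q≢1) (inj₂ (1∣ q))
    ; v∼w₂ = ∼-byOrders order-v order-w (order≢⇒≢ order-v order-w q≢M) (inj₁ q∣M)
    ; v∼w₃ = ∼-byOrders order-v order-w⁻¹ (order≢⇒≢ order-v order-w⁻¹ q≢M) (inj₁ q∣M)
    ; w₁∼w₂ = ∼-byOrders order-ε order-w (order≢⇒≢ order-ε order-w (M≢1 ∘ sym)) (inj₁ (1∣ M))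
    ; w₁∼w₃ = ∼-byOrders order-ε order-w⁻¹ (order≢⇒≢ order-ε order-w⁻¹ (M≢1 ∘ sym)) (inj₁ (1∣ M))
    ; w₂∼w₃ = ∼-byOrders order-w order-w⁻¹ w≢w⁻¹ (inj₁ ∣-refl)
    }
    where
    order-u : IsOrder (pow w a) p
    order-u = order-pow order-w a (sym M≡ap)
    order-v : IsOrder (pow w b) q
    order-v = order-pow order-w b (sym M≡bq)
    order-w⁻¹ : IsOrder (w ⁻¹) M
    order-w⁻¹ = order-⁻¹ order-w
    p∤q : ¬ p ∣ q
    p∤q = prime∤prime p-prime q-prime p≢q
    q∤p : ¬ q ∣ p
    q∤p = prime∤prime q-prime p-prime (p≢q ∘ sym)
    u≁v : ¬ SAdj G (pow w a) (pow w b)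
    u≁v (_ , k , l , order-u' , order-v' , k|l) with order-unique order-u order-u' | order-unique order-v order-v'
    ... | refl | refl = [ p∤q , q∤p ]′ k|l
    p≢1 : p ≢ 1
    p≢1 refl = ¬prime[1] p-prime
    q≢1 : q ≢ 1
    q≢1 refl = ¬prime[1] q-prime
    M≢1 : M ≢ 1
    M≢1 refl = p≢1 (∣1⇒≡1 p∣M)
    p≢M : p ≢ M
    p≢M refl = q∤p q∣M
    q≢M : q ≢ M
    q≢M refl = p∤q p∣M
    w≢w⁻¹ : w ≢ w ⁻¹
    w≢w⁻¹ w≡w⁻¹ = p≢q (trans (≡2 p-prime p∣M) (sym (≡2 q-prime q∣M)))
      where
      M∣2 : M ∣ 2
      M∣2 = order∣ order-w (trans (cong (w ∙_) (trans (identityʳ w) w≡w⁻¹)) (inverseʳ w))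
      ≡2 : ∀ {r} → Prime r → r ∣ M → r ≡ 2
      ≡2 r-prime r∣M = prime∣power⇒≡ prime[2] 1 r-prime (∣-trans r∣M M∣2)

isLineGraphS⇒noK5MinusEdge : ∀ {n} (G : FiniteGroup n) → IsLineGraphS G → ¬ K5MinusEdge (SAdj G)
isLineGraphS⇒noK5MinusEdge G (_ , Γ , f , SAdj⇔LAdj) =
  LineGraph.noK5MinusEdge Γ ∘ K5MinusEdge-embed (Inverse.to f) (Injection.injective (↔⇒↣ f)) SAdj⇔LAdj

mainTheorem2 : (n : ℕ) (G : FiniteGroup n) → IsNilpotent G → (IsLineGraphS G ⇔ IsPGroup G)
mainTheorem2 n G nilpotent = mk⇔ lineGraph⇒pGroup (complete⇒isLineGraphS G ∘ pGroup⇒complete)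
  where
  open GroupTheory G using (nilpotent⇒pGroup⊎mixedOrder)
  open OrderSupergraph G using (pGroup⇒complete; mixedOrder⇒K5MinusEdge)
  lineGraph⇒pGroup : IsLineGraphS G → IsPGroup G
  lineGraph⇒pGroup lineGraph with nilpotent⇒pGroup⊎mixedOrder nilpotent
  ... | inj₁ pGroup = pGroup
  ... | inj₂ mixed  = contradiction (mixedOrder⇒K5MinusEdge mixed) (isLineGraphS⇒noK5MinusEdge G lineGraph)
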